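{- Let $n,k$ be integers with $n > 2k \geq 4$, let $X=\{1,\ldots,n\}$, and let $\mathcal A := \left\{A \in \binom{X}{k}\colon |A \cap \{1,2,3\}| \geq 2\right\}$. Then $$|\mathcal I(\mathcal A)| = 3 \sum_{0 \leq i \leq k - 2} \binom{n - 3}{i} + 3 \sum_{0 \leq i \leq k - 3} \binom{n - 3}{i} + \sum_{0 \leq i \leq k - 4} \binom{n - 3}{i}.$$
   Context: $\binom{X}{k}$ denotes the family of all $k$-element subsets of $X$. For a family $\mathcal F$, $\mathcal I(\mathcal F) := \{F \cap F'\colon F, F' \in \mathcal F,\ F \neq F'\}$. Empty sums (e.g. over $0\le i\le -1$) are zero. -}

module Defs where

open import Data.Nat using (ℕ; zero; suc; _+_; _<ᵇ_)
open import Data.Nat.Combinatorics using (_C_)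
open import Data.Fin using (Fin; toℕ)
open import Data.Fin.Subset using (Subset; _∩_; ∣_∣; inside; outside)
open import Data.Vec using (tabulate)
open import Data.Bool using (if_then_else_)
open import Data.Product using (Σ; _×_)
open import Data.List using (List; length)
open import Data.List.Membership.Propositional using (_∈_)
open import Data.List.Relation.Unary.Unique.Propositional using (Unique)
open import Relation.Binary.PropositionalEquality using (_≡_; _≢_)
open import Function.Bundles using (_⇔_)

-- X = {1,…,n} is modelled as Fin n, with element j ↦ index j-1.
-- {1,2,3} ∩ X as a subset of Fin n (elements with index < 3).
first3 : (n : ℕ) → Subset n
first3 n = tabulate (λ i → if toℕ i <ᵇ 3 then inside else outside)

InA : (n k : ℕ) → Subset n → Set
InA n k A = (∣ A ∣ ≡ k) × (2 Data.Nat.≤ ∣ A ∩ first3 n ∣)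

InI : (n k : ℕ) → Subset n → Set
InI n k S = Σ (Subset n) λ F → Σ (Subset n) λ F' →
  InA n k F × InA n k F' × (F ≢ F') × (F ∩ F' ≡ S)

HasCard : {n : ℕ} → (Subset n → Set) → ℕ → Set
HasCard {n} P m = Σ (List (Subset n)) λ L →
  Unique L × ((S : Subset n) → (S ∈ L ⇔ P S)) × (length L ≡ m)

-- psum m j = Σ_{0 ≤ i < j} (m choose i)  (empty sum when j = 0).
-- So Σ_{0 ≤ i ≤ k - r} (m choose i) = psum m (k ∸ (r - 1)), correctly empty when k < r.
psum : ℕ → ℕ → ℕ
psum m zero = 0
psum m (suc j) = psum m j + m C j

-- Split X = {1,2,3} ∪ Y and a set S ⊆ X as S = t ∪ s with t ⊆ {1,2,3}, s ⊆ Y.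
-- S is the intersection of two distinct members of 𝒜 exactly when t ≠ ∅ and |S| < k:
-- two 2-subsets of a 3-set meet, and two distinct k-sets meet in fewer than k points.
-- Conversely, enlarge t inside {1,2,3} to two sets of size ≥ 2 meeting in t, and enlarge s
-- by two disjoint blocks of equal size up to size k; the blocks fit into Y because n > 2k.
-- Hence |𝓘(𝒜)| = Σ_{∅ ≠ t ⊆ {1,2,3}} Σ_{i < k - |t|} (n-3 choose i), and there are
-- 3, 3 and 1 choices of t of size 1, 2 and 3.
module Submission where

open import Defs
open import Data.Nat using (ℕ; zero; suc; _+_; _*_; _∸_; _≤_; _<_; _≤?_; s≤s)
open import Data.Nat.Properties
open import Data.Nat.Combinatorics using (_C_; nCk+nC[k+1]≡[n+1]C[k+1])
open import Data.Nat.ListAction using (sum)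
open import Data.Nat.Solver using (module +-*-Solver)
open import Data.Vec using (Vec; []; _∷_; _++_; tabulate; replicate; splitAt)
open import Data.Vec.Properties using (tabulate-cong; ∷-injectiveʳ; ++-injectiveˡ; ++-injectiveʳ; zipWith-++; tabulate∘lookup; lookup-replicate)
open import Data.Fin.Subset using (Subset; _∩_; _∪_; ∣_∣; inside; outside; ⊤; ⊥)
open import Data.Fin.Subset.Properties using (∣p∣≤n; ∣p∩q∣≤∣p∣; ∩-comm; ∩-idem; ∩-identityʳ; ∩-zeroʳ; ∣⊥∣≡0)
open import Data.List using (List; []; _∷_; map; length; filter; [_]) renaming (_++_ to _++ₗ_)
open import Data.List.Properties using (length-++; length-map)
open import Data.List.Membership.Propositional using (_∈_)
open import Data.List.Membership.Propositional.Properties using (∈-map⁺; ∈-map⁻; ∈-++⁺ˡ; ∈-++⁺ʳ; ∈-++⁻; ∈-filter⁺; ∈-filter⁻)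
open import Data.List.Relation.Unary.Any using (here; there)
open import Data.List.Relation.Unary.Unique.Propositional using (Unique)
open import Data.List.Relation.Unary.AllPairs using ([]; _∷_)
open import Data.List.Relation.Unary.All using ([])
import Data.List.Relation.Unary.Unique.Propositional.Properties as Unique
open import Data.Product using (_×_; _,_; ∃₂; ∃-syntax; uncurry)
open import Data.Product.Function.NonDependent.Propositional using (_×-⇔_)
open import Data.Sum using (inj₁; inj₂)
open import Function.Bundles using (_⇔_; mk⇔; Equivalence)
import Function.Properties.Equivalence as ⇔
open import Relation.Nullary using (¬_; contradiction)
open import Relation.Binary.PropositionalEquality using (_≡_; _≢_; refl; sym; trans; cong; cong₂; subst; subst₂; module ≡-Reasoning)

ofSize : (m i : ℕ) → List (Subset m)
ofSize zero    zero    = [ [] ]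
ofSize zero    (suc i) = []
ofSize (suc m) zero    = map (outside ∷_) (ofSize m zero)
ofSize (suc m) (suc i) = map (inside ∷_) (ofSize m i) ++ₗ map (outside ∷_) (ofSize m (suc i))

∈-ofSize⁺ : ∀ {m i} (s : Subset m) → ∣ s ∣ ≡ i → s ∈ ofSize m i
∈-ofSize⁺ {i = zero}  []            refl = here refl
∈-ofSize⁺ {i = zero}  (outside ∷ s) eq   = ∈-map⁺ (outside ∷_) (∈-ofSize⁺ s eq)
∈-ofSize⁺ {i = suc i} (inside ∷ s)  eq   = ∈-++⁺ˡ (∈-map⁺ (inside ∷_) (∈-ofSize⁺ s (suc-injective eq)))
∈-ofSize⁺ {i = suc i} (outside ∷ s) eq   = ∈-++⁺ʳ _ (∈-map⁺ (outside ∷_) (∈-ofSize⁺ s eq))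

∈-ofSize⁻ : ∀ m i {s : Subset m} → s ∈ ofSize m i → ∣ s ∣ ≡ i
∈-ofSize⁻ zero    zero    (here refl) = refl
∈-ofSize⁻ (suc m) zero    s∈ with ∈-map⁻ (outside ∷_) s∈
... | _ , s∈′ , refl = ∈-ofSize⁻ m zero s∈′
∈-ofSize⁻ (suc m) (suc i) s∈ with ∈-++⁻ (map (inside ∷_) (ofSize m i)) s∈
... | inj₁ s∈ᵢ with ∈-map⁻ (inside ∷_) s∈ᵢ
...   | _ , s∈′ , refl = cong suc (∈-ofSize⁻ m i s∈′)
∈-ofSize⁻ (suc m) (suc i) s∈ | inj₂ s∈ₒ with ∈-map⁻ (outside ∷_) s∈ₒ
...   | _ , s∈′ , refl = ∈-ofSize⁻ m (suc i) s∈′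

ofSize-unique : ∀ m i → Unique (ofSize m i)
ofSize-unique zero    zero    = [] ∷ []
ofSize-unique zero    (suc i) = []
ofSize-unique (suc m) zero    = Unique.map⁺ ∷-injectiveʳ (ofSize-unique m zero)
ofSize-unique (suc m) (suc i) = Unique.++⁺
  (Unique.map⁺ ∷-injectiveʳ (ofSize-unique m i))
  (Unique.map⁺ ∷-injectiveʳ (ofSize-unique m (suc i)))
  λ (s∈ᵢ , s∈ₒ) → inside≢outside (∈-map⁻ (inside ∷_) s∈ᵢ) (∈-map⁻ (outside ∷_) s∈ₒ)
  where
  inside≢outside : ∀ {s : Subset (suc m)} {xs ys : List (Subset m)} →
    ∃[ x ] x ∈ xs × s ≡ inside ∷ x → ¬ (∃[ y ] y ∈ ys × s ≡ outside ∷ y)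
  inside≢outside (_ , _ , refl) (_ , _ , ())

length-ofSize : ∀ m i → length (ofSize m i) ≡ m C i
length-ofSize zero    zero    = refl
length-ofSize zero    (suc i) = refl
length-ofSize (suc m) zero    = trans (length-map _ (ofSize m zero)) (length-ofSize m zero)
length-ofSize (suc m) (suc i) = begin
  length (map (inside ∷_) (ofSize m i) ++ₗ map (outside ∷_) (ofSize m (suc i)))
    ≡⟨ length-++ (map (inside ∷_) (ofSize m i)) ⟩
  length (map (inside ∷_) (ofSize m i)) + length (map (outside ∷_) (ofSize m (suc i)))
    ≡⟨ cong₂ _+_ (length-map _ (ofSize m i)) (length-map _ (ofSize m (suc i))) ⟩
  length (ofSize m i) + length (ofSize m (suc i))
    ≡⟨ cong₂ _+_ (length-ofSize m i) (length-ofSize m (suc i)) ⟩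
  m C i + m C suc i
    ≡⟨ nCk+nC[k+1]≡[n+1]C[k+1] m i ⟩
  suc m C suc i ∎
  where open ≡-Reasoning

ofSizeBelow : (m j : ℕ) → List (Subset m)
ofSizeBelow m zero    = []
ofSizeBelow m (suc j) = ofSizeBelow m j ++ₗ ofSize m j

∈-ofSizeBelow : ∀ m j {s : Subset m} → s ∈ ofSizeBelow m j ⇔ ∣ s ∣ < j
∈-ofSizeBelow m j = mk⇔ (to j) (from j)
  where
  to : ∀ j {s} → s ∈ ofSizeBelow m j → ∣ s ∣ < j
  to (suc j) s∈ with ∈-++⁻ (ofSizeBelow m j) s∈
  ... | inj₁ s∈< = m<n⇒m<1+n (to j s∈<)
  ... | inj₂ s∈≡ = ≤-reflexive (cong suc (∈-ofSize⁻ m j s∈≡))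
  from : ∀ j {s} → ∣ s ∣ < j → s ∈ ofSizeBelow m j
  from (suc j) {s} |s|<1+j with m<1+n⇒m<n∨m≡n |s|<1+j
  ... | inj₁ |s|<j = ∈-++⁺ˡ (from j |s|<j)
  ... | inj₂ |s|≡j = ∈-++⁺ʳ (ofSizeBelow m j) (∈-ofSize⁺ s |s|≡j)

ofSizeBelow-unique : ∀ m j → Unique (ofSizeBelow m j)
ofSizeBelow-unique m zero    = []
ofSizeBelow-unique m (suc j) = Unique.++⁺ (ofSizeBelow-unique m j) (ofSize-unique m j)
  λ (s∈< , s∈≡) → <-irrefl (∈-ofSize⁻ m j s∈≡) (Equivalence.to (∈-ofSizeBelow m j) s∈<)

length-ofSizeBelow : ∀ m j → length (ofSizeBelow m j) ≡ psum m j
length-ofSizeBelow m zero    = refl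
length-ofSizeBelow m (suc j) = trans (length-++ (ofSizeBelow m j))
  (cong₂ _+_ (length-ofSizeBelow m j) (length-ofSize m j))

nonempty : (n : ℕ) → List (Subset n)
nonempty n = filter (λ t → 1 ≤? ∣ t ∣) (ofSizeBelow n (suc n))

∈-nonempty : ∀ n {t : Subset n} → t ∈ nonempty n ⇔ 1 ≤ ∣ t ∣
∈-nonempty n {t} = mk⇔
  (λ t∈ → let _ , 1≤|t| = ∈-filter⁻ (λ t → 1 ≤? ∣ t ∣) {xs = ofSizeBelow n (suc n)} t∈ in 1≤|t|)
  (∈-filter⁺ (λ t → 1 ≤? ∣ t ∣) (Equivalence.from (∈-ofSizeBelow n (suc n)) (s≤s (∣p∣≤n t))))

nonempty-unique : ∀ n → Unique (nonempty n)
nonempty-unique n = Unique.filter⁺ (λ t → 1 ≤? ∣ t ∣) (ofSizeBelow-unique n (suc n))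

module _ {A : Set} {a b : ℕ} where

  withPrefixes : List (Vec A a) → (Vec A a → List (Vec A b)) → List (Vec A (a + b))
  withPrefixes []       g = []
  withPrefixes (t ∷ ts) g = map (t ++_) (g t) ++ₗ withPrefixes ts g

  ∈-withPrefixes⁺ : ∀ ts g {t s} → t ∈ ts → s ∈ g t → t ++ s ∈ withPrefixes ts g
  ∈-withPrefixes⁺ (t ∷ ts) g (here refl) s∈ = ∈-++⁺ˡ (∈-map⁺ (t ++_) s∈)
  ∈-withPrefixes⁺ (u ∷ ts) g (there t∈) s∈ = ∈-++⁺ʳ _ (∈-withPrefixes⁺ ts g t∈ s∈)

  ∈-withPrefixes⁻ : ∀ ts g {t s} → t ++ s ∈ withPrefixes ts g → t ∈ ts × s ∈ g t
  ∈-withPrefixes⁻ (u ∷ ts) g {t} ts∈ with ∈-++⁻ (map (u ++_) (g u)) ts∈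
  ... | inj₂ ts∈′ = let t∈ , s∈ = ∈-withPrefixes⁻ ts g ts∈′ in there t∈ , s∈
  ... | inj₁ ts∈ᵤ with ∈-map⁻ (u ++_) ts∈ᵤ
  ...   | _ , s∈ , eq with ++-injectiveˡ t u eq | ++-injectiveʳ t u eq
  ...     | refl | refl = here refl , s∈

  withPrefixes-unique : ∀ {ts} g → Unique ts → (∀ t → Unique (g t)) → Unique (withPrefixes ts g)
  withPrefixes-unique {[]}     g []             _ = []
  withPrefixes-unique {u ∷ ts} g (u∉ts ∷ !ts) !g = Unique.++⁺
    (Unique.map⁺ (++-injectiveʳ u u) (!g u))
    (withPrefixes-unique g !ts !g)
    λ (v∈ᵤ , v∈) →
      let _ , _ , v≡u++s = ∈-map⁻ (u ++_) v∈ᵤ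
          u∈ts , _ = ∈-withPrefixes⁻ ts g (subst (_∈ withPrefixes ts g) v≡u++s v∈)
      in Unique.Unique[x∷xs]⇒x∉xs (u∉ts ∷ !ts) u∈ts

  length-withPrefixes : ∀ ts g (c : Vec A a → ℕ) → (∀ t → length (g t) ≡ c t) →
    length (withPrefixes ts g) ≡ sum (map c ts)
  length-withPrefixes []       g c |g|≡c = refl
  length-withPrefixes (t ∷ ts) g c |g|≡c = begin
    length (map (t ++_) (g t) ++ₗ withPrefixes ts g)
      ≡⟨ length-++ (map (t ++_) (g t)) ⟩
    length (map (t ++_) (g t)) + length (withPrefixes ts g)
      ≡⟨ cong₂ _+_ (trans (length-map (t ++_) (g t)) (|g|≡c t)) (length-withPrefixes ts g c |g|≡c) ⟩
    c t + sum (map c ts) ∎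
    where open ≡-Reasoning

hasCard-withPrefixes : ∀ {a b} {P : Subset (a + b) → Set} ts (g : Subset a → List (Subset b)) (c : Subset a → ℕ) →
  Unique ts → (∀ t → Unique (g t)) → (∀ t → length (g t) ≡ c t) →
  (∀ t s → (t ∈ ts × s ∈ g t) ⇔ P (t ++ s)) → HasCard P (sum (map c ts))
hasCard-withPrefixes {a} {P = P} ts g c !ts !g |g|≡c ∈⇔P =
  withPrefixes ts g , withPrefixes-unique g !ts !g , ∈⇔ , length-withPrefixes ts g c |g|≡c
  where
  ∈⇔ : ∀ S → S ∈ withPrefixes ts g ⇔ P S
  ∈⇔ S with splitAt a S
  ... | t , s , refl = ⇔.trans (mk⇔ (∈-withPrefixes⁻ ts g) (uncurry (∈-withPrefixes⁺ ts g))) (∈⇔P t s)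

∣p++q∣≡∣p∣+∣q∣ : ∀ {a b} (p : Subset a) (q : Subset b) → ∣ p ++ q ∣ ≡ ∣ p ∣ + ∣ q ∣
∣p++q∣≡∣p∣+∣q∣ []            q = refl
∣p++q∣≡∣p∣+∣q∣ (inside ∷ p)  q = cong suc (∣p++q∣≡∣p∣+∣q∣ p q)
∣p++q∣≡∣p∣+∣q∣ (outside ∷ p) q = ∣p++q∣≡∣p∣+∣q∣ p q

∣p∣+∣q∣≡∣p∩q∣+∣p∪q∣ : ∀ {n} (p q : Subset n) → ∣ p ∣ + ∣ q ∣ ≡ ∣ p ∩ q ∣ + ∣ p ∪ q ∣
∣p∣+∣q∣≡∣p∩q∣+∣p∪q∣ []            []            = refl
∣p∣+∣q∣≡∣p∩q∣+∣p∪q∣ (inside ∷ p)  (inside ∷ q)  = cong suc (begin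
  ∣ p ∣ + suc ∣ q ∣             ≡⟨ +-suc ∣ p ∣ ∣ q ∣ ⟩
  suc (∣ p ∣ + ∣ q ∣)           ≡⟨ cong suc (∣p∣+∣q∣≡∣p∩q∣+∣p∪q∣ p q) ⟩
  suc (∣ p ∩ q ∣ + ∣ p ∪ q ∣)   ≡⟨ +-suc ∣ p ∩ q ∣ ∣ p ∪ q ∣ ⟨
  ∣ p ∩ q ∣ + suc ∣ p ∪ q ∣     ∎)
  where open ≡-Reasoning
∣p∣+∣q∣≡∣p∩q∣+∣p∪q∣ (inside ∷ p)  (outside ∷ q) =
  trans (cong suc (∣p∣+∣q∣≡∣p∩q∣+∣p∪q∣ p q)) (sym (+-suc ∣ p ∩ q ∣ ∣ p ∪ q ∣))
∣p∣+∣q∣≡∣p∩q∣+∣p∪q∣ (outside ∷ p) (inside ∷ q)  =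
  trans (+-suc ∣ p ∣ ∣ q ∣) (trans (cong suc (∣p∣+∣q∣≡∣p∩q∣+∣p∪q∣ p q)) (sym (+-suc ∣ p ∩ q ∣ ∣ p ∪ q ∣)))
∣p∣+∣q∣≡∣p∩q∣+∣p∪q∣ (outside ∷ p) (outside ∷ q) = ∣p∣+∣q∣≡∣p∩q∣+∣p∪q∣ p q

∣p∣+∣q∣≤∣p∩q∣+n : ∀ {n} (p q : Subset n) → ∣ p ∣ + ∣ q ∣ ≤ ∣ p ∩ q ∣ + n
∣p∣+∣q∣≤∣p∩q∣+n p q = ≤-trans (≤-reflexive (∣p∣+∣q∣≡∣p∩q∣+∣p∪q∣ p q)) (+-monoʳ-≤ ∣ p ∩ q ∣ (∣p∣≤n (p ∪ q)))

∣p∩q∣≡∣p∣⇒p∩q≡p : ∀ {n} (p q : Subset n) → ∣ p ∩ q ∣ ≡ ∣ p ∣ → p ∩ q ≡ p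
∣p∩q∣≡∣p∣⇒p∩q≡p []            []            _   = refl
∣p∩q∣≡∣p∣⇒p∩q≡p (inside ∷ p)  (inside ∷ q)  eq  = cong (inside ∷_) (∣p∩q∣≡∣p∣⇒p∩q≡p p q (suc-injective eq))
∣p∩q∣≡∣p∣⇒p∩q≡p (inside ∷ p)  (outside ∷ q) eq  = contradiction eq (<⇒≢ (s≤s (∣p∩q∣≤∣p∣ p q)))
∣p∩q∣≡∣p∣⇒p∩q≡p (outside ∷ p) (_ ∷ q)       eq  = cong (outside ∷_) (∣p∩q∣≡∣p∣⇒p∩q≡p p q eq)

p≢q⇒∣p∩q∣<∣p∣ : ∀ {n} (p q : Subset n) → ∣ p ∣ ≡ ∣ q ∣ → p ≢ q → ∣ p ∩ q ∣ < ∣ p ∣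
p≢q⇒∣p∩q∣<∣p∣ p q |p|≡|q| p≢q = ≤∧≢⇒< (∣p∩q∣≤∣p∣ p q) λ |p∩q|≡|p| → p≢q (begin
  p      ≡⟨ ∣p∩q∣≡∣p∣⇒p∩q≡p p q |p∩q|≡|p| ⟨
  p ∩ q  ≡⟨ ∩-comm p q ⟩
  q ∩ p  ≡⟨ ∣p∩q∣≡∣p∣⇒p∩q≡p q p (trans (cong ∣_∣ (∩-comm q p)) (trans |p∩q|≡|p| |p|≡|q|)) ⟩
  q      ∎)
  where open ≡-Reasoning

∣p∩q∣<∣p∣⇒p≢q : ∀ {n} (p q : Subset n) → ∣ p ∩ q ∣ < ∣ p ∣ → p ≢ q
∣p∩q∣<∣p∣⇒p≢q p .p |p∩p|<|p| refl = <-irrefl (cong ∣_∣ (∩-idem p)) |p∩p|<|p|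

∩-++ : ∀ {a b} (p p′ : Subset a) (q q′ : Subset b) → (p ++ q) ∩ (p′ ++ q′) ≡ (p ∩ p′) ++ (q ∩ q′)
∩-++ p p′ q q′ = zipWith-++ _ p q p′ q′

supersets-meeting-in : ∀ {n} (s : Subset n) p q → ∣ s ∣ + (p + q) ≤ n →
  ∃₂ λ s₁ s₂ → s₁ ∩ s₂ ≡ s × ∣ s₁ ∣ ≡ ∣ s ∣ + p × ∣ s₂ ∣ ≡ ∣ s ∣ + q
supersets-meeting-in []            zero    zero    _ = [] , [] , refl , refl , refl
supersets-meeting-in (inside ∷ s)  p       q       (s≤s room)
  with s₁ , s₂ , s₁∩s₂≡s , |s₁|≡ , |s₂|≡ ← supersets-meeting-in s p q room
  = inside ∷ s₁ , inside ∷ s₂ , cong (inside ∷_) s₁∩s₂≡s , cong suc |s₁|≡ , cong suc |s₂|≡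
supersets-meeting-in (outside ∷ s) zero    zero    _ =
  outside ∷ s , outside ∷ s , cong (outside ∷_) (∩-idem s) , sym (+-identityʳ ∣ s ∣) , sym (+-identityʳ ∣ s ∣)
supersets-meeting-in (outside ∷ s) (suc p) q       room
  with s₁ , s₂ , s₁∩s₂≡s , |s₁|≡ , |s₂|≡ ← supersets-meeting-in s p q (≤-pred (≤-trans (≤-reflexive (sym (+-suc ∣ s ∣ (p + q)))) room))
  = inside ∷ s₁ , outside ∷ s₂ , cong (outside ∷_) s₁∩s₂≡s , trans (cong suc |s₁|≡) (sym (+-suc ∣ s ∣ p)) , |s₂|≡
supersets-meeting-in (outside ∷ s) zero    (suc q) room
  with s₁ , s₂ , s₁∩s₂≡s , |s₁|≡ , |s₂|≡ ← supersets-meeting-in s zero q (≤-pred (≤-trans (≤-reflexive (sym (+-suc ∣ s ∣ q))) room))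
  = outside ∷ s₁ , inside ∷ s₂ , cong (outside ∷_) s₁∩s₂≡s , |s₁|≡ , trans (cong suc |s₂|≡) (sym (+-suc ∣ s ∣ q))

first3≡⊤++⊥ : ∀ m → first3 (3 + m) ≡ ⊤ {3} ++ ⊥ {m}
first3≡⊤++⊥ m = cong (λ r → inside ∷ inside ∷ inside ∷ r)
  (trans (tabulate-cong (λ i → sym (lookup-replicate i outside))) (tabulate∘lookup (replicate m outside)))

∣[t++s]∩first3∣≡∣t∣ : ∀ {m} (t : Subset 3) (s : Subset m) → ∣ (t ++ s) ∩ first3 (3 + m) ∣ ≡ ∣ t ∣
∣[t++s]∩first3∣≡∣t∣ {m} t s = begin
  ∣ (t ++ s) ∩ first3 (3 + m) ∣  ≡⟨ cong (λ f → ∣ (t ++ s) ∩ f ∣) (first3≡⊤++⊥ m) ⟩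
  ∣ (t ++ s) ∩ (⊤ {3} ++ ⊥) ∣    ≡⟨ cong ∣_∣ (∩-++ t ⊤ s ⊥) ⟩
  ∣ (t ∩ ⊤) ++ (s ∩ ⊥) ∣         ≡⟨ cong₂ (λ t′ s′ → ∣ t′ ++ s′ ∣) (∩-identityʳ t) (∩-zeroʳ s) ⟩
  ∣ t ++ ⊥ ∣                     ≡⟨ ∣p++q∣≡∣p∣+∣q∣ t ⊥ ⟩
  ∣ t ∣ + ∣ ⊥ {m} ∣              ≡⟨ cong (∣ t ∣ +_) (∣⊥∣≡0 m) ⟩
  ∣ t ∣ + 0                      ≡⟨ +-identityʳ ∣ t ∣ ⟩
  ∣ t ∣                          ∎
  where open ≡-Reasoning

InA-++ : ∀ {m k} (t : Subset 3) (s : Subset m) → ∣ t ∣ + ∣ s ∣ ≡ k → 2 ≤ ∣ t ∣ → InA (3 + m) k (t ++ s)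
InA-++ t s |t|+|s|≡k 2≤|t| =
  trans (∣p++q∣≡∣p∣+∣q∣ t s) |t|+|s|≡k , subst (2 ≤_) (sym (∣[t++s]∩first3∣≡∣t∣ t s)) 2≤|t|

2≤∣p∣⇒2≤∣q∣⇒1≤∣p∩q∣ : (p q : Subset 3) → 2 ≤ ∣ p ∣ → 2 ≤ ∣ q ∣ → 1 ≤ ∣ p ∩ q ∣
2≤∣p∣⇒2≤∣q∣⇒1≤∣p∩q∣ p q 2≤|p| 2≤|q| =
  +-cancelʳ-≤ 3 1 ∣ p ∩ q ∣ (≤-trans (+-mono-≤ 2≤|p| 2≤|q|) (∣p∣+∣q∣≤∣p∩q∣+n p q))

InI-++⇒ : ∀ {m k} (t : Subset 3) (s : Subset m) → InI (3 + m) k (t ++ s) → 1 ≤ ∣ t ∣ × ∣ t ∣ + ∣ s ∣ < k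
InI-++⇒ {k = k} t s (F , F′ , (|F|≡k , 2≤|F∩first3|) , (|F′|≡k , 2≤|F′∩first3|) , F≢F′ , F∩F′≡ts)
  with splitAt 3 F | splitAt 3 F′
... | t₁ , s₁ , refl | t₂ , s₂ , refl = 1≤|t| , |t|+|s|<k
  where
  1≤|t₁∩t₂| : 1 ≤ ∣ t₁ ∩ t₂ ∣
  1≤|t₁∩t₂| = 2≤∣p∣⇒2≤∣q∣⇒1≤∣p∩q∣ t₁ t₂
    (subst (2 ≤_) (∣[t++s]∩first3∣≡∣t∣ t₁ s₁) 2≤|F∩first3|)
    (subst (2 ≤_) (∣[t++s]∩first3∣≡∣t∣ t₂ s₂) 2≤|F′∩first3|)
  1≤|t| : 1 ≤ ∣ t ∣
  1≤|t| = subst (λ u → 1 ≤ ∣ u ∣) (++-injectiveˡ (t₁ ∩ t₂) t (trans (sym (∩-++ t₁ t₂ s₁ s₂)) F∩F′≡ts)) 1≤|t₁∩t₂|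
  |t|+|s|<k : ∣ t ∣ + ∣ s ∣ < k
  |t|+|s|<k = subst₂ _<_ (trans (cong ∣_∣ F∩F′≡ts) (∣p++q∣≡∣p∣+∣q∣ t s)) |F|≡k
    (p≢q⇒∣p∩q∣<∣p∣ (t₁ ++ s₁) (t₂ ++ s₂) (trans |F|≡k (sym |F′|≡k)) F≢F′)

pair-meeting-in : (t : Subset 3) → 1 ≤ ∣ t ∣ →
  ∃₂ λ t₁ t₂ → t₁ ∩ t₂ ≡ t × ∣ t₂ ∣ ≡ ∣ t₁ ∣ × 2 ≤ ∣ t₁ ∣ × ∣ t₁ ∣ ≤ suc ∣ t ∣
pair-meeting-in (outside ∷ outside ∷ outside ∷ []) ()
pair-meeting-in (inside  ∷ outside ∷ outside ∷ []) _ =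
  inside ∷ inside ∷ outside ∷ [] , inside ∷ outside ∷ inside ∷ [] , refl , refl , ≤-refl , ≤-refl
pair-meeting-in (outside ∷ inside  ∷ outside ∷ []) _ =
  inside ∷ inside ∷ outside ∷ [] , outside ∷ inside ∷ inside ∷ [] , refl , refl , ≤-refl , ≤-refl
pair-meeting-in (outside ∷ outside ∷ inside  ∷ []) _ =
  inside ∷ outside ∷ inside ∷ [] , outside ∷ inside ∷ inside ∷ [] , refl , refl , ≤-refl , ≤-refl
pair-meeting-in t@(inside  ∷ inside  ∷ outside ∷ []) _ = t , t , ∩-idem t , refl , ≤-refl , n≤1+n 2
pair-meeting-in t@(inside  ∷ outside ∷ inside  ∷ []) _ = t , t , ∩-idem t , refl , ≤-refl , n≤1+n 2
pair-meeting-in t@(outside ∷ inside  ∷ inside  ∷ []) _ = t , t , ∩-idem t , refl , ≤-refl , n≤1+n 2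
pair-meeting-in t@(inside  ∷ inside  ∷ inside  ∷ []) _ = t , t , ∩-idem t , refl , n≤1+n 2 , n≤1+n 3

room-for-tails : ∀ j s p m → 2 ≤ j → 2 * (j + s + p) < 3 + m → s + (p + p) ≤ m
room-for-tails j s p m 2≤j 2k<3+m = ≤-trans (m≤n+m (s + (p + p)) 2) (≤-pred (≤-pred (begin
  4 + (s + (p + p))              ≤⟨ +-mono-≤ (+-mono-≤ 2≤j 2≤j) (m≤n+m (s + (p + p)) s) ⟩
  (j + j) + (s + (s + (p + p)))  ≡⟨ solve 3 (λ j s p → (j :+ j) :+ (s :+ (s :+ (p :+ p))) := con 2 :* (j :+ s :+ p)) refl j s p ⟩
  2 * (j + s + p)                ≤⟨ ≤-pred 2k<3+m ⟩
  2 + m                          ∎)))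
  where open ≤-Reasoning
        open +-*-Solver

InI-++⇐ : ∀ {m k} → 2 * k < 3 + m → (t : Subset 3) (s : Subset m) → 1 ≤ ∣ t ∣ → ∣ t ∣ + ∣ s ∣ < k →
  InI (3 + m) k (t ++ s)
-- F ≢ F′ needs no separate argument: F ∩ F′ = t ++ s is smaller than F.
InI-++⇐ {m} {k} 2k<3+m t s 1≤|t| |t|+|s|<k
  with t₁ , t₂ , t₁∩t₂≡t , |t₂|≡|t₁| , 2≤|t₁| , |t₁|≤1+|t| ← pair-meeting-in t 1≤|t|
  with p , |t₁|+|s|+p≡k ← m≤n⇒∃[o]m+o≡n (≤-trans (+-monoˡ-≤ ∣ s ∣ |t₁|≤1+|t|) |t|+|s|<k)
  with s₁ , s₂ , s₁∩s₂≡s , |s₁|≡|s|+p , |s₂|≡|s|+p ← supersets-meeting-in s p p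
         (room-for-tails ∣ t₁ ∣ ∣ s ∣ p m 2≤|t₁| (subst (λ k → 2 * k < 3 + m) (sym |t₁|+|s|+p≡k) 2k<3+m))
  = t₁ ++ s₁ , t₂ ++ s₂ , InA-++ t₁ s₁ |t₁|+|s₁|≡k 2≤|t₁| , InA-++ t₂ s₂ |t₂|+|s₂|≡k (subst (2 ≤_) (sym |t₂|≡|t₁|) 2≤|t₁|) ,
    ∣p∩q∣<∣p∣⇒p≢q (t₁ ++ s₁) (t₂ ++ s₂) |F∩F′|<|F| , F∩F′≡ts
  where
  |t₁|+|s₁|≡k : ∣ t₁ ∣ + ∣ s₁ ∣ ≡ k
  |t₁|+|s₁|≡k = trans (cong (∣ t₁ ∣ +_) |s₁|≡|s|+p) (trans (sym (+-assoc ∣ t₁ ∣ ∣ s ∣ p)) |t₁|+|s|+p≡k)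
  |t₂|+|s₂|≡k : ∣ t₂ ∣ + ∣ s₂ ∣ ≡ k
  |t₂|+|s₂|≡k = trans (cong₂ _+_ |t₂|≡|t₁| (trans |s₂|≡|s|+p (sym |s₁|≡|s|+p))) |t₁|+|s₁|≡k
  F∩F′≡ts : (t₁ ++ s₁) ∩ (t₂ ++ s₂) ≡ t ++ s
  F∩F′≡ts = trans (∩-++ t₁ t₂ s₁ s₂) (cong₂ _++_ t₁∩t₂≡t s₁∩s₂≡s)
  |F∩F′|<|F| : ∣ (t₁ ++ s₁) ∩ (t₂ ++ s₂) ∣ < ∣ t₁ ++ s₁ ∣
  |F∩F′|<|F| = subst₂ _<_ (trans (sym (∣p++q∣≡∣p∣+∣q∣ t s)) (cong ∣_∣ (sym F∩F′≡ts)))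
    (sym (trans (∣p++q∣≡∣p∣+∣q∣ t₁ s₁) |t₁|+|s₁|≡k)) |t|+|s|<k

InI-++⇔ : ∀ {m k} → 2 * k < 3 + m → (t : Subset 3) (s : Subset m) →
  InI (3 + m) k (t ++ s) ⇔ (1 ≤ ∣ t ∣ × ∣ t ∣ + ∣ s ∣ < k)
InI-++⇔ 2k<3+m t s = mk⇔ (InI-++⇒ t s) (uncurry (InI-++⇐ 2k<3+m t s))

m<o∸n⇔n+m<o : ∀ m n o → m < o ∸ n ⇔ n + m < o
m<o∸n⇔n+m<o m zero    o       = ⇔.refl
m<o∸n⇔n+m<o m (suc n) zero    = mk⇔ (λ ()) (λ ())
m<o∸n⇔n+m<o m (suc n) (suc o) = ⇔.trans (m<o∸n⇔n+m<o m n o) (mk⇔ s≤s ≤-pred)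

hasCard-InI : ∀ m k → 2 * k < 3 + m →
  HasCard (InI (3 + m) k) (3 * psum m (k ∸ 1) + 3 * psum m (k ∸ 2) + psum m (k ∸ 3))
hasCard-InI m k 2k<3+m = subst (HasCard (InI (3 + m) k)) count
  (hasCard-withPrefixes (nonempty 3) (λ t → ofSizeBelow m (k ∸ ∣ t ∣)) (λ t → psum m (k ∸ ∣ t ∣))
    (nonempty-unique 3) (λ t → ofSizeBelow-unique m (k ∸ ∣ t ∣)) (λ t → length-ofSizeBelow m (k ∸ ∣ t ∣))
    λ t s → ⇔.trans (∈-nonempty 3 ×-⇔ ⇔.trans (∈-ofSizeBelow m (k ∸ ∣ t ∣)) (m<o∸n⇔n+m<o ∣ s ∣ ∣ t ∣ k))
                    (⇔.sym (InI-++⇔ 2k<3+m t s)))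
  where
  open +-*-Solver
  -- nonempty 3 computes to the subsets of sizes 1, 1, 1, 2, 2, 2, 3 in this order.
  count : sum (map (λ t → psum m (k ∸ ∣ t ∣)) (nonempty 3)) ≡ 3 * psum m (k ∸ 1) + 3 * psum m (k ∸ 2) + psum m (k ∸ 3)
  count = solve 3 (λ a b c → a :+ (a :+ (a :+ (b :+ (b :+ (b :+ (c :+ con 0)))))) := con 3 :* a :+ con 3 :* b :+ c)
    refl (psum m (k ∸ 1)) (psum m (k ∸ 2)) (psum m (k ∸ 3))

proposition1p5 : (n k : ℕ) → 4 ≤ 2 * k → 2 * k < n →
    HasCard (InI n k) (3 * psum (n ∸ 3) (k ∸ 1) + 3 * psum (n ∸ 3) (k ∸ 2) + psum (n ∸ 3) (k ∸ 3))
proposition1p5 n k 4≤2k 2k<n with m , refl ← m≤n⇒∃[o]m+o≡n (≤-trans (n≤1+n 3) (≤-trans 4≤2k (<⇒≤ 2k<n)))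
  = hasCard-InI m k 2k<n
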